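{- Let $\Omega$ be a set of orderings and let $x$ and $y$ be two distinct initial elements of $\Omega$. Then for any integers $i$ and $j$ with $j>1$ and $j\ne i+1$, $f_{x,y}(i,j-1)\ge f_{x,y}(i,j)$.
   Context: A set of orderings $\Omega$ on a finite set $S$ of $n$ elements is a nonempty set of total orderings of $S$. The rank of an element in an ordering is its position, the first position being $1$. For distinct elements $x,y$ and integers $i,j$, $f_{x,y}(i,j)$ is the probability that, in an ordering chosen uniformly at random from $\Omega$, $x$ has rank $i$ and $y$ has rank $j$. An element $x$ is initial if, in any ordering of $\Omega$ in which $x$ is not the first element, swapping $x$ with its immediate predecessor produces another ordering of $\Omega$. -}

module Defs where

open import Data.Nat using (ℕ; zero; suc; NonZero)
open import Data.Fin using (Fin)
open import Data.Fin.Properties using () renaming (_≟_ to _≟ᶠ_)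
open import Data.Integer using (ℤ; +_) renaming (_≟_ to _≟ℤ_)
open import Data.Rational using (ℚ; _/_)
open import Data.List using (List; []; _∷_; length; filter)
open import Data.List.Relation.Unary.Unique.Propositional using (Unique)
open import Data.List.Membership.Propositional using (_∈_)
open import Data.Maybe using (Maybe; just; nothing)
open import Data.Product using (_×_)
open import Relation.Binary.PropositionalEquality using (_≡_)
open import Relation.Nullary using (yes; no)
open import Relation.Nullary.Decidable using (_×-dec_)

-- The finite set S of n elements is Fin n.
-- A total ordering of S is a list of the elements of S (first element first)
-- in which every element occurs exactly once.
IsOrdering : (n : ℕ) → List (Fin n) → Set
IsOrdering n σ = Unique σ × length σ ≡ n

-- 0-based indexing into a list.
_!!_ : {A : Set} → List A → ℕ → Maybe A
[] !! _ = nothing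
(a ∷ l) !! zero = just a
(a ∷ l) !! suc k = l !! k

-- Swap the entries at 0-based positions k and k+1 (identity if out of range).
swapAt : {A : Set} → ℕ → List A → List A
swapAt zero (a ∷ b ∷ l) = b ∷ a ∷ l
swapAt zero l = l
swapAt (suc k) [] = []
swapAt (suc k) (a ∷ l) = a ∷ swapAt k l

-- Rank (1-based position) of x in σ; 0 if x does not occur (never happens
-- for an ordering).
rank : {n : ℕ} → Fin n → List (Fin n) → ℕ
rank x [] = 0
rank x (a ∷ l) with a ≟ᶠ x
... | yes _ = 1
... | no _ with rank x l
...   | zero = zero
...   | suc r = suc (suc r)

-- x is initial in Ω: whenever x is not first in an ordering σ ∈ Ω
-- (i.e. x sits at 0-based position k+1), swapping x with its immediate
-- predecessor gives an ordering in Ω.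
Initial : {n : ℕ} → List (List (Fin n)) → Fin n → Set
Initial Ω x = ∀ σ → σ ∈ Ω → ∀ k → σ !! suc k ≡ just x → swapAt k σ ∈ Ω

count : {n : ℕ} → List (List (Fin n)) → Fin n → Fin n → ℤ → ℤ → ℕ
count Ω x y i j =
  length (filter (λ σ → ((+ rank x σ) ≟ℤ i) ×-dec ((+ rank y σ) ≟ℤ j)) Ω)

f : {n : ℕ} (Ω : List (List (Fin n))) → .{{NonZero (length Ω)}} →
    Fin n → Fin n → ℤ → ℤ → ℚ
f Ω x y i j = (+ count Ω x y i j) / length Ω

module Submission where

-- Write j = m + 2.  Swapping the entries at 0-based
-- positions m and m+1 (the map swapAt m) sends every σ ∈ Ω in which x has
-- rank i and y has rank j to an ordering in which y has rank j - 1: it lies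
-- in Ω because y is initial, and x keeps its rank i because x occupied
-- neither of the two swapped positions (position j is taken by y ≠ x, and
-- j - 1 ≠ i by hypothesis).  Since swapAt m is an involution, hence
-- injective, and Ω has no repeated elements, this injection shows
-- count Ω x y i j ≤ count Ω x y i (j - 1); dividing by |Ω| gives the claim.

open import Defs
open import Data.Nat using (ℕ; NonZero)
open import Data.Fin using (Fin)
open import Data.Integer using (ℤ; +_; _+_; _-_; _>_)
open import Data.Rational using (_≤_)
open import Data.List using (List; length)
open import Data.List.Relation.Unary.All using (All)
open import Data.List.Relation.Unary.Unique.Propositional using (Unique)
open import Relation.Binary.PropositionalEquality using (_≢_)

open import Data.Nat using (zero; suc; s≤s; z≤n)
import Data.Nat as ℕ
import Data.Nat.Properties as ℕP
import Data.Integer as ℤ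
import Data.Integer.Properties as ℤP
import Data.Rational as ℚ
import Data.Rational.Properties as ℚP
import Data.Rational.Unnormalised as ℚᵘ
import Data.Rational.Unnormalised.Properties as ℚᵘP
open import Data.Fin.Properties using () renaming (_≟_ to _≟ᶠ_)
open import Data.List using ([]; _∷_; _++_; map; filter)
open import Data.List.Properties using (length-++; length-map)
open import Data.List.Membership.Propositional using (_∈_)
open import Data.List.Membership.Propositional.Properties
  using (∈-∃++; ∈-++⁻; ∈-++⁺ˡ; ∈-++⁺ʳ; ∈-filter⁺; ∈-filter⁻; ∈-map⁻)
open import Data.List.Relation.Unary.Any using (here; there)
open import Data.List.Relation.Unary.AllPairs using (_∷_)
import Data.List.Relation.Unary.All as All
import Data.List.Relation.Unary.Unique.Propositional.Properties as Unique
open import Data.Maybe using (just)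
open import Data.Product using (_×_; _,_; ∃)
open import Data.Sum using (inj₁; inj₂)
open import Data.Empty using (⊥-elim)
open import Function using (_∘_)
open import Level using (0ℓ)
open import Relation.Nullary using (yes; no)
open import Relation.Nullary.Decidable using (_×-dec_; toSum)
open import Relation.Unary using (Pred; Decidable)
open import Relation.Binary.PropositionalEquality
  using (_≡_; refl; sym; trans; cong; subst; module ≡-Reasoning)

module _ {A : Set} where

  delete-∈ : ∀ {v : A} {ys} → v ∈ ys →
             ∃ λ zs → length ys ≡ suc (length zs) ×
                      (∀ {z} → z ∈ ys → z ≢ v → z ∈ zs)
  delete-∈ {v} v∈ys with ∈-∃++ v∈ys
  ... | ys₁ , ys₂ , refl = ys₁ ++ ys₂ , length-eq , keep
    where
    length-eq : length (ys₁ ++ v ∷ ys₂) ≡ suc (length (ys₁ ++ ys₂))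
    length-eq = begin
      length (ys₁ ++ v ∷ ys₂)          ≡⟨ length-++ ys₁ ⟩
      length ys₁ ℕ.+ suc (length ys₂)  ≡⟨ ℕP.+-suc (length ys₁) (length ys₂) ⟩
      suc (length ys₁ ℕ.+ length ys₂)  ≡⟨ cong suc (sym (length-++ ys₁)) ⟩
      suc (length (ys₁ ++ ys₂))        ∎
      where open ≡-Reasoning
    keep : ∀ {z} → z ∈ ys₁ ++ v ∷ ys₂ → z ≢ v → z ∈ ys₁ ++ ys₂
    keep z∈ z≢v with ∈-++⁻ ys₁ z∈
    ... | inj₁ z∈ys₁         = ∈-++⁺ˡ z∈ys₁
    ... | inj₂ (here z≡v)    = ⊥-elim (z≢v z≡v)
    ... | inj₂ (there z∈ys₂) = ∈-++⁺ʳ ys₁ z∈ys₂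

  unique-⊆⇒length-≤ : ∀ {xs ys : List A} → Unique xs →
                      (∀ {z} → z ∈ xs → z ∈ ys) → length xs ℕ.≤ length ys
  unique-⊆⇒length-≤ {[]}     _             _  = z≤n
  unique-⊆⇒length-≤ {x ∷ xs} (x∉xs ∷ !xs) xs⊆ys
    with zs , length-ys , keep ← delete-∈ (xs⊆ys (here refl)) =
    subst (suc (length xs) ℕ.≤_) (sym length-ys)
      (s≤s (unique-⊆⇒length-≤ !xs λ z∈xs →
        keep (xs⊆ys (there z∈xs)) (λ z≡x → All.lookup x∉xs z∈xs (sym z≡x))))

  filter-length-≤-by-injection :
    {P Q : Pred A 0ℓ} (P? : Decidable P) (Q? : Decidable Q) {Ω : List A} →
    Unique Ω → (g : A → A) → (∀ {a b} → g a ≡ g b → a ≡ b) →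
    (∀ {a} → a ∈ Ω → P a → g a ∈ Ω × Q (g a)) →
    length (filter P? Ω) ℕ.≤ length (filter Q? Ω)
  filter-length-≤-by-injection P? Q? {Ω} !Ω g g-inj g-maps =
    subst (ℕ._≤ length (filter Q? Ω)) (length-map g (filter P? Ω))
      (unique-⊆⇒length-≤ (Unique.map⁺ g-inj (Unique.filter⁺ P? !Ω)) image⊆)
    where
    image⊆ : ∀ {z} → z ∈ map g (filter P? Ω) → z ∈ filter Q? Ω
    image⊆ z∈
      with a , a∈ , refl ← ∈-map⁻ g z∈
      with a∈Ω , Pa ← ∈-filter⁻ P? a∈
      with ga∈Ω , Qga ← g-maps a∈Ω Pa = ∈-filter⁺ Q? ga∈Ω Qga

/-monoˡ-≤ : ∀ {a b} m .{{_ : NonZero m}} → a ℕ.≤ b → (+ a) ℚ./ m ≤ (+ b) ℚ./ m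
/-monoˡ-≤ {a} {b} (suc k) a≤b = ℚP.toℚᵘ-cancel-≤ (begin
  ℚ.toℚᵘ (ℚ.fromℚᵘ (ℚᵘ.mkℚᵘ (+ a) k)) ≃⟨ ℚP.toℚᵘ-fromℚᵘ (ℚᵘ.mkℚᵘ (+ a) k) ⟩
  ℚᵘ.mkℚᵘ (+ a) k                       ≤⟨ ℚᵘ.*≤* (ℤP.*-monoʳ-≤-nonNeg (+ suc k) (ℤ.+≤+ a≤b)) ⟩
  ℚᵘ.mkℚᵘ (+ b) k                       ≃⟨ ℚP.toℚᵘ-fromℚᵘ (ℚᵘ.mkℚᵘ (+ b) k) ⟨
  ℚ.toℚᵘ (ℚ.fromℚᵘ (ℚᵘ.mkℚᵘ (+ b) k)) ∎)
  where open ℚᵘP.≤-Reasoning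

-- The rank of x in a ∷ l when a ≠ x: one more than its rank in l, where
-- rank 0 (x absent) stays 0.
rankStep : ℕ → ℕ
rankStep zero    = zero
rankStep (suc r) = suc (suc r)

rankStep-suc-inv : ∀ {k r} → rankStep k ≡ suc r → ∃ λ r′ → r ≡ suc r′ × k ≡ suc r′
rankStep-suc-inv {suc k} refl = k , refl , refl

module _ {n : ℕ} (x : Fin n) where

  rank-here : ∀ l → rank x (x ∷ l) ≡ 1
  rank-here l with x ≟ᶠ x
  ... | yes _   = refl
  ... | no x≢x  = ⊥-elim (x≢x refl)

  rank-there : ∀ {a} l → a ≢ x → rank x (a ∷ l) ≡ rankStep (rank x l)
  rank-there {a} l a≢x with a ≟ᶠ x
  ... | yes a≡x = ⊥-elim (a≢x a≡x)
  ... | no _ with rank x l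
  ...   | zero  = refl
  ...   | suc _ = refl

  rank⇒lookup : ∀ σ {r} → rank x σ ≡ suc r → σ !! r ≡ just x
  rank⇒lookup (a ∷ l) rank≡ with toSum (a ≟ᶠ x)
  ... | inj₁ refl with refl ← trans (sym (rank-here l)) rank≡ = refl
  ... | inj₂ a≢x with _ , refl , rank-l ← rankStep-suc-inv (trans (sym (rank-there l a≢x)) rank≡)
    = rank⇒lookup l rank-l

  rank-swap-forward : ∀ m σ → rank x σ ≡ suc (suc m) → rank x (swapAt m σ) ≡ suc m
  rank-swap-forward zero σ rank≡ with rank⇒lookup σ rank≡
  rank-swap-forward zero (a ∷ b ∷ l) _ | refl = rank-here (a ∷ l)
  rank-swap-forward (suc m) (a ∷ l) rank≡ with toSum (a ≟ᶠ x)
  ... | inj₁ refl with () ← trans (sym (rank-here l)) rank≡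
  ... | inj₂ a≢x with _ , refl , rank-l ← rankStep-suc-inv (trans (sym (rank-there l a≢x)) rank≡)
    = trans (rank-there (swapAt m l) a≢x) (cong rankStep (rank-swap-forward m l rank-l))

  rank-swap-elsewhere : ∀ m σ → rank x σ ≢ suc m → rank x σ ≢ suc (suc m) →
                        rank x (swapAt m σ) ≡ rank x σ
  rank-swap-elsewhere zero    []          _ _ = refl
  rank-swap-elsewhere zero    (a ∷ [])    _ _ = refl
  rank-swap-elsewhere zero    (a ∷ b ∷ l) ≢1 ≢2 with toSum (a ≟ᶠ x) | toSum (b ≟ᶠ x)
  ... | inj₁ refl | _         = ⊥-elim (≢1 (rank-here (b ∷ l)))
  ... | inj₂ a≢x  | inj₁ refl =
    ⊥-elim (≢2 (trans (rank-there (b ∷ l) a≢x) (cong rankStep (rank-here l))))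
  ... | inj₂ a≢x  | inj₂ b≢x  = begin
    rank x (b ∷ a ∷ l)             ≡⟨ rank-there (a ∷ l) b≢x ⟩
    rankStep (rank x (a ∷ l))      ≡⟨ cong rankStep (rank-there l a≢x) ⟩
    rankStep (rankStep (rank x l)) ≡⟨ cong rankStep (rank-there l b≢x) ⟨
    rankStep (rank x (b ∷ l))      ≡⟨ rank-there (b ∷ l) a≢x ⟨
    rank x (a ∷ b ∷ l)             ∎
    where open ≡-Reasoning
  rank-swap-elsewhere (suc m) []      _ _ = refl
  rank-swap-elsewhere (suc m) (a ∷ l) ≢m+1 ≢m+2 with toSum (a ≟ᶠ x)
  ... | inj₁ refl = trans (rank-here (swapAt m l)) (sym (rank-here l))
  ... | inj₂ a≢x  = begin
    rank x (a ∷ swapAt m l)        ≡⟨ rank-there (swapAt m l) a≢x ⟩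
    rankStep (rank x (swapAt m l)) ≡⟨ cong rankStep
                                        (rank-swap-elsewhere m l (≢m+1 ∘ shift) (≢m+2 ∘ shift)) ⟩
    rankStep (rank x l)            ≡⟨ rank-there l a≢x ⟨
    rank x (a ∷ l)                 ∎
    where
    open ≡-Reasoning
    shift : ∀ {r} → rank x l ≡ r → rank x (a ∷ l) ≡ rankStep r
    shift refl = rank-there l a≢x

swapAt-involutive : {A : Set} → ∀ k (l : List A) → swapAt k (swapAt k l) ≡ l
swapAt-involutive zero    []          = refl
swapAt-involutive zero    (a ∷ [])    = refl
swapAt-involutive zero    (a ∷ b ∷ l) = refl
swapAt-involutive (suc k) []          = refl
swapAt-involutive (suc k) (a ∷ l)     = cong (a ∷_) (swapAt-involutive k l)

swapAt-injective : {A : Set} → ∀ k {l l′ : List A} → swapAt k l ≡ swapAt k l′ → l ≡ l′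
swapAt-injective k {l} {l′} eq = begin
  l                       ≡⟨ swapAt-involutive k l ⟨
  swapAt k (swapAt k l)   ≡⟨ cong (swapAt k) eq ⟩
  swapAt k (swapAt k l′)  ≡⟨ swapAt-involutive k l′ ⟩
  l′                      ∎
  where open ≡-Reasoning

RanksAt : {n : ℕ} → Fin n → Fin n → ℤ → ℤ → Pred (List (Fin n)) 0ℓ
RanksAt x y i j σ = (+ rank x σ ≡ i) × (+ rank y σ ≡ j)

ranksAt? : {n : ℕ} (x y : Fin n) (i j : ℤ) → Decidable (RanksAt x y i j)
ranksAt? x y i j σ = (+ rank x σ ℤ.≟ i) ×-dec (+ rank y σ ℤ.≟ j)

swap-before-initial : {n : ℕ} {Ω : List (List (Fin n))} {x y : Fin n} →
  x ≢ y → Initial Ω y → ∀ {i} m → + suc m ≢ i →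
  ∀ {σ} → σ ∈ Ω → RanksAt x y i (+ suc (suc m)) σ →
  swapAt m σ ∈ Ω × RanksAt x y i (+ suc m) (swapAt m σ)
swap-before-initial {x = x} {y} x≢y y-initial m m+1≢i {σ} σ∈Ω (x-rank , +y-rank) =
  y-initial σ σ∈Ω m (rank⇒lookup y σ y-rank) ,
  trans (cong +_ (rank-swap-elsewhere x m σ x-not-at-m+1 x-not-at-m+2)) x-rank ,
  cong +_ (rank-swap-forward y m σ y-rank)
  where
  y-rank : rank y σ ≡ suc (suc m)
  y-rank = ℤP.+-injective +y-rank
  x-not-at-m+1 : rank x σ ≢ suc m
  x-not-at-m+1 rank≡ = m+1≢i (trans (cong +_ (sym rank≡)) x-rank)
  x-not-at-m+2 : rank x σ ≢ suc (suc m)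
  x-not-at-m+2 rank≡ with refl ← trans (sym (rank⇒lookup x σ rank≡)) (rank⇒lookup y σ y-rank)
    = x≢y refl

lemma7 : (n : ℕ) (Ω : List (List (Fin n))) → All (IsOrdering n) Ω → Unique Ω →
         (ne : NonZero (length Ω)) → (x y : Fin n) → x ≢ y →
         Initial Ω x → Initial Ω y → (i j : ℤ) → j > + 1 → j ≢ i + + 1 →
         f Ω {{ne}} x y i j ≤ f Ω {{ne}} x y i (j - + 1)
lemma7 _ _ _ _ _ _ _ _ _ _ _ (+ zero)     (ℤ.+<+ ())       _
lemma7 _ _ _ _ _ _ _ _ _ _ _ (+ suc zero) (ℤ.+<+ (s≤s ())) _
lemma7 _ Ω _ !Ω ne x y x≢y _ y-initial i (+ suc (suc m)) _ j≢i+1 =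
  /-monoˡ-≤ (length Ω) {{ne}}
    (filter-length-≤-by-injection (ranksAt? x y i (+ suc (suc m)))
      (ranksAt? x y i (+ suc m)) !Ω (swapAt m) (swapAt-injective m)
      (swap-before-initial x≢y y-initial m m+1≢i))
  where
  m+1≢i : + suc m ≢ i
  m+1≢i m+1≡i = j≢i+1 (trans (cong +_ (ℕP.+-comm 1 (suc m))) (cong (ℤ._+ + 1) m+1≡i))
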